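{- Let $\mathbf V$ be a commutative unital quantale and let $\mathbf H=(\mathbf A,F)$ be a $\mathbf V$-F-semilattice. Then: (1) For every $\mathbf V$-frame $\mathbf J=(T,r)$ there is a unique homomorphism of $\mathbf V$-frames $\varphi_{\mathbf J}\colon\mathbf J\to\mathbf J[\mathbf H,\mathbf J\otimes\mathbf H]$ such that $(\varphi_{\mathbf J}(i))(x)=\mathrm n(j[\mathbf J,\mathbf H])(x_{i=})$ for all $x\in A$, $i\in T$ (in particular each $\varphi_{\mathbf J}(i)$ is a module homomorphism $\mathbf A\to\mathbf J\otimes\mathbf H$). Moreover $\varphi=(\varphi_{\mathbf J})_{\mathbf J}$ is a natural transformation from the identity functor on $\mathbf V$-$\mathbb J$ to $\mathbf J[\mathbf H,-\otimes\mathbf H]$, i.e. $\mathbf J[\mathbf H,t\otimes\mathbf H]\circ\varphi_{\mathbf J_1}=\varphi_{\mathbf J_2}\circ t$ for every frame homomorphism $t\colon\mathbf J_1\to\mathbf J_2$. (2) For every $\mathbf V$-module $\mathbf L$ there is a unique module homomorphism $\psi_{\mathbf L}\colon\mathbf J[\mathbf H,\mathbf L]\otimes\mathbf H\to\mathbf L$ with $\psi_{\mathbf L}\circ\mathrm n(j[\mathbf J[\mathbf H,\mathbf L],\mathbf H])=f_{\mathbf L}$, where $f_{\mathbf L}\colon A^{T_{[\mathbf H,\mathbf L]}}\to L$ is $f_{\mathbf L}(x)=\bigvee_{\alpha\in T_{[\mathbf H,\mathbf L]}}\alpha(x(\alpha))$. Moreover $\psi=(\psi_{\mathbf L})_{\mathbf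 L}$ is a natural transformation from $\mathbf J[\mathbf H,-]\otimes\mathbf H$ to the identity functor on $\mathbf V$-$\mathbb S$, i.e. $\psi_{\mathbf L_2}\circ(\mathbf J[\mathbf H,g]\otimes\mathbf H)=g\circ\psi_{\mathbf L_1}$ for every module homomorphism $g\colon\mathbf L_1\to\mathbf L_2$. (3) $(\varphi,\psi)$ is an adjoint situation $(-\otimes\mathbf H)\dashv\mathbf J[\mathbf H,-]$ between $-\otimes\mathbf H\colon\mathbf V\text{ - }\mathbb J\to\mathbf V\text{ - }\mathbb S$ and $\mathbf J[\mathbf H,-]\colon\mathbf V\text{ - }\mathbb S\to\mathbf V\text{ - }\mathbb J$; that is, $\psi_{\mathbf J\otimes\mathbf H}\circ(\varphi_{\mathbf J}\otimes\mathbf H)=\mathrm{id}_{\mathbf J\otimes\mathbf H}$ and $\mathbf J[\mathbf H,\psi_{\mathbf L}]\circ\varphi_{\mathbf J[\mathbf H,\mathbf L]}=\mathrm{id}_{\mathbf J[\mathbf H,\mathbf L]}$ for all $\mathbf J$ and $\mathbf L$.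
   Context: A commutative unital quantale $\mathbf V=(V,\bigvee,\otimes,e)$: $(V,\bigvee)$ a complete lattice, $(V,\otimes,e)$ a commutative monoid, $\otimes$ distributing over arbitrary joins. A $\mathbf V$-module $\mathbf A=(A,\bigvee,*)$ is a complete lattice with $*\colon V\times A\to A$ preserving arbitrary joins in each argument, $u*(v*a)=(u\otimes v)*a$, $e*a=a$. Module homomorphisms preserve arbitrary joins and $f(v*a)=v*f(a)$; $\mathbf V$-$\mathbb S$ is the category of modules. A $\mathbf V$-frame is $\mathbf J=(T,r)$ with $r\colon T\times T\to V$; a frame homomorphism $f\colon(T,r)\to(S,s)$ is a map with $r(i,j)\le s(f(i),f(j))$; $\mathbf V$-$\mathbb J$ is the category of frames. A $\mathbf V$-F-semilattice is $(\mathbf A,F)$ with $F$ a module endomorphism. Prenuclei: for a module $\mathbf M$ (with identity operator), a prenucleus is $j\colon M\to M$ with $a\le j(a)$, monotone, $v*j(a)\le j(v*a)$. $M_j=\{a\mid j(a)=a\}$; $\mathrm n(j)(a)=\bigwedge\{x\in M_j\mid a\le x\}$; for a nucleus $k$ (idempotent prenucleus), $M_k$ is a module with joins $k(\bigvee S)$ and action $k(v*m)$. For $X\subseteq M\times M$, $j[X](a)=a\vee\bigvee\{c\mid\exists d\le a:(c,d)\in X\text{ or }(d,c)\in X\}$. Tensor: for a frame $\mathbf J=(T,r)$, F-semilattice $\mathbf H=(\mathbf A,F)$, $x\in A$, $i\in T$: $x_{ir}\in A^T$, $x_{ir}(j)=r(i,j)*x$; $x_{i=}\in A^T$, $x_{i=}(i)=x$,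 $x_{i=}(j)=0$ for $j\ne i$. $[\mathbf J,\mathbf H]=\{(x_{ir}\vee F(x)_{i=},F(x)_{i=})\mid x\in A,i\in T\}$, $j[\mathbf J,\mathbf H]=j[[\mathbf J,\mathbf H]]$ in the pointwise module $\mathbf A^T$, and $\mathbf J\otimes\mathbf H=(\mathbf A^T)_{\mathrm n(j[\mathbf J,\mathbf H])}$, with $\mathrm n(j[\mathbf J,\mathbf H])$ regarded as a surjective module homomorphism $A^T\to\mathbf J\otimes\mathbf H$. For a frame homomorphism $t\colon(T_1,r_1)\to(T_2,r_2)$, $t^{\rightarrow}\colon A^{T_1}\to A^{T_2}$ is $(t^{\rightarrow}(x))(k)=\bigvee\{x(i)\mid t(i)=k\}$, and $t\otimes\mathbf H\colon\mathbf J_1\otimes\mathbf H\to\mathbf J_2\otimes\mathbf H$ is the unique module homomorphism with $\mathrm n(j[\mathbf J_2,\mathbf H])\circ t^{\rightarrow}=(t\otimes\mathbf H)\circ\mathrm n(j[\mathbf J_1,\mathbf H])$. Frame of homomorphisms: for a module $\mathbf L$ and $a,b\in L$ let $a\rightarrow b=\bigvee\{v\in V\mid v*a\le b\}$. $T_{[\mathbf H,\mathbf L]}$ is the set of module homomorphisms $\mathbf A\to\mathbf L$, and $\mathbf J[\mathbf H,\mathbf L]=(T_{[\mathbf H,\mathbf L]},r)$ with $r(\alpha,\beta)=\bigwedge_{x\in A}(\beta(x)\rightarrow\alpha(F(x)))$. For a module homomorphism $g\colon\mathbf L_1\to\mathbf L_2$, $\mathbf J[\mathbf H,g]\colon\alpha\mapsto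 g\circ\alpha$. -}

module Defs where

open import Data.Product using (Σ; _×_; _,_; proj₁; proj₂)
open import Data.Sum using (_⊎_; inj₁; inj₂)
open import Data.Bool using (Bool; true; false)
open import Data.Empty using () renaming (⊥ to Empty)
open import Relation.Binary.PropositionalEquality using (_≡_; refl)

-- A complete lattice is presented as a preorder with
-- joins of all (Set-indexed) families; equality of elements is the
-- induced equivalence _≈_ (mutual ≤), i.e. we work in the poset reflection.

record CompleteLattice : Set₁ where
  infix 4 _≤_ _≈_
  field
    Carrier : Set
    _≤_     : Carrier → Carrier → Set
    ≤-refl  : ∀ {a} → a ≤ a
    ≤-trans : ∀ {a b c} → a ≤ b → b ≤ c → a ≤ c
    ⋁       : {I : Set} → (I → Carrier) → Carrier
    ⋁-ub    : {I : Set} (f : I → Carrier) (i : I) → f i ≤ ⋁ f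
    ⋁-least : {I : Set} (f : I → Carrier) {a : Carrier} →
              ((i : I) → f i ≤ a) → ⋁ f ≤ a

  _≈_ : Carrier → Carrier → Set
  a ≈ b = (a ≤ b) × (b ≤ a)

  ≈-refl : ∀ {a} → a ≈ a
  ≈-refl = ≤-refl , ≤-refl

  ≈-sym : ∀ {a b} → a ≈ b → b ≈ a
  ≈-sym (p , q) = q , p

  ≈-trans : ∀ {a b c} → a ≈ b → b ≈ c → a ≈ c
  ≈-trans (p , q) (p' , q') = ≤-trans p p' , ≤-trans q' q

  ⋀ : {I : Set} → (I → Carrier) → Carrier
  ⋀ {I} f = ⋁ {Σ Carrier (λ y → (i : I) → y ≤ f i)} proj₁

  ⋀-lb : {I : Set} (f : I → Carrier) (i : I) → ⋀ f ≤ f i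
  ⋀-lb f i = ⋁-least proj₁ (λ p → proj₂ p i)

  ⋀-glb : {I : Set} (f : I → Carrier) {a : Carrier} →
          ((i : I) → a ≤ f i) → a ≤ ⋀ f
  ⋀-glb f {a} h = ⋁-ub proj₁ (a , h)

  ⊥ₗ : Carrier
  ⊥ₗ = ⋁ {Empty} (λ ())

  pick : Carrier → Carrier → Bool → Carrier
  pick a b true  = a
  pick a b false = b

  _∨_ : Carrier → Carrier → Carrier
  a ∨ b = ⋁ {Bool} (pick a b)

  ∨-left : ∀ {a b} → a ≤ a ∨ b
  ∨-left {a} {b} = ⋁-ub (pick a b) true

  ∨-right : ∀ {a b} → b ≤ a ∨ b
  ∨-right {a} {b} = ⋁-ub (pick a b) false

  ∨-least : ∀ {a b c} → a ≤ c → b ≤ c → a ∨ b ≤ c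
  ∨-least {a} {b} p q = ⋁-least (pick a b) (λ { true → p ; false → q })

  ⋁-mono : {I : Set} (f g : I → Carrier) → ((i : I) → f i ≤ g i) → ⋁ f ≤ ⋁ g
  ⋁-mono f g h = ⋁-least f (λ i → ≤-trans (h i) (⋁-ub g i))

  ⋁-cong : {I : Set} (f g : I → Carrier) → ((i : I) → f i ≈ g i) → ⋁ f ≈ ⋁ g
  ⋁-cong f g h = ⋁-mono f g (λ i → proj₁ (h i)) , ⋁-mono g f (λ i → proj₂ (h i))

record Quantale : Set₁ where
  field
    lattice : CompleteLattice
  open CompleteLattice lattice public
  infixl 7 _⊗_
  field
    _⊗_         : Carrier → Carrier → Carrier
    e           : Carrier
    ⊗-mono      : ∀ {u u' v v'} → u ≤ u' → v ≤ v' → u ⊗ v ≤ u' ⊗ v'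
    ⊗-assoc     : ∀ u v w → (u ⊗ v) ⊗ w ≈ u ⊗ (v ⊗ w)
    ⊗-comm      : ∀ u v → u ⊗ v ≈ v ⊗ u
    ⊗-identityˡ : ∀ u → e ⊗ u ≈ u
    -- (by commutativity this gives distributivity on both sides)
    ⊗-distrib-⋁ : ∀ {I : Set} u (f : I → Carrier) → u ⊗ ⋁ f ≈ ⋁ (λ i → u ⊗ f i)

record Module (V : Quantale) : Set₁ where
  private module V = Quantale V
  field
    lattice : CompleteLattice
  open CompleteLattice lattice public
  infixr 7 _*_
  field
    _*_        : V.Carrier → Carrier → Carrier
    *-mono     : ∀ {u u' a a'} → u V.≤ u' → a ≤ a' → u * a ≤ u' * a'
    *-⋁ʳ       : ∀ {I : Set} u (f : I → Carrier) → u * ⋁ f ≈ ⋁ (λ i → u * f i)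
    *-⋁ˡ       : ∀ {I : Set} (g : I → V.Carrier) a → V.⋁ g * a ≈ ⋁ (λ i → g i * a)
    *-assoc    : ∀ u v a → u * (v * a) ≈ (u V.⊗ v) * a
    *-identity : ∀ a → V.e * a ≈ a

  _⇒_ : Carrier → Carrier → V.Carrier
  a ⇒ b = V.⋁ {Σ V.Carrier (λ v → v * a ≤ b)} proj₁

-- Module homomorphisms.
-- "Preserves arbitrary joins" is expressed (for predicativity reasons, so
-- that the type of homomorphisms is small) by: monotone and, for every b,
-- f (⋁ {a | f a ≤ b}) ≤ b.  'Hom-⋁' and 'mkHom' below show this is
-- equivalent to f (⋁ g) ≈ ⋁ (f ∘ g) for all families g.

record Hom {V : Quantale} (A L : Module V) : Set where
  private
    module A = Module A
    module L = Module L
  field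
    fun   : A.Carrier → L.Carrier
    mono  : ∀ {a b} → a A.≤ b → fun a L.≤ fun b
    ⋁-pres : ∀ b → fun (A.⋁ {Σ A.Carrier (λ a → fun a L.≤ b)} proj₁) L.≤ b
    *-pres : ∀ v a → fun (v A.* a) L.≈ v L.* fun a

module _ {V : Quantale} {A L : Module V} where
  private
    module A = Module A
    module L = Module L

  Hom-⋁ : (f : Hom A L) {I : Set} (g : I → A.Carrier) →
          Hom.fun f (A.⋁ g) L.≈ L.⋁ (λ i → Hom.fun f (g i))
  Hom-⋁ f g =
    L.≤-trans (Hom.mono f (A.⋁-least g (λ i → A.⋁-ub proj₁ (g i , L.⋁-ub _ i))))
              (Hom.⋁-pres f _)
    , L.⋁-least _ (λ i → Hom.mono f (A.⋁-ub g i))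

  mkHom : (fun : A.Carrier → L.Carrier) →
          (∀ {a b} → a A.≤ b → fun a L.≤ fun b) →
          (∀ {I : Set} (g : I → A.Carrier) → fun (A.⋁ g) L.≈ L.⋁ (λ i → fun (g i))) →
          (∀ v a → fun (v A.* a) L.≈ v L.* fun a) → Hom A L
  mkHom fun mono pres act = record
    { fun = fun ; mono = mono
    ; ⋁-pres = λ b → L.≤-trans (proj₁ (pres proj₁)) (L.⋁-least _ proj₂)
    ; *-pres = act }

_∘H_ : {V : Quantale} {A B C : Module V} → Hom B C → Hom A B → Hom A C
_∘H_ {V} {A} {B} {C} g f =
  mkHom (λ a → Hom.fun g (Hom.fun f a))
        (λ p → Hom.mono g (Hom.mono f p))
        (λ h → C.≈-trans (C.≈-refl {Hom.fun g (Hom.fun f (A.⋁ h))})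
                 (C.≈-trans (Hom.mono g (proj₁ (Hom-⋁ f h)) , Hom.mono g (proj₂ (Hom-⋁ f h)))
                            (Hom-⋁ g (λ i → Hom.fun f (h i)))))
        (λ v a → C.≈-trans (Hom.mono g (proj₁ (Hom.*-pres f v a)) , Hom.mono g (proj₂ (Hom.*-pres f v a)))
                           (Hom.*-pres g v (Hom.fun f a)))
  where
    module A = Module A
    module C = Module C

record Frame (V : Quantale) : Set₁ where
  field
    T : Set
    r : T → T → Quantale.Carrier V

record FrameHom {V : Quantale} (J K : Frame V) : Set where
  field
    fun   : Frame.T J → Frame.T K
    r-le  : ∀ i j → Quantale._≤_ V (Frame.r J i j) (Frame.r K (fun i) (fun j))

record FSemilattice (V : Quantale) : Set₁ where
  field
    mod : Module V
    F   : Hom mod mod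

module _ {V : Quantale} where
  private module V = Quantale V

  _^_ : Module V → Set → Module V
  A ^ T = record
    { lattice = record
        { Carrier = T → A.Carrier
        ; _≤_ = λ x y → (t : T) → x t A.≤ y t
        ; ≤-refl = λ t → A.≤-refl
        ; ≤-trans = λ p q t → A.≤-trans (p t) (q t)
        ; ⋁ = λ f t → A.⋁ (λ i → f i t)
        ; ⋁-ub = λ f i t → A.⋁-ub (λ i → f i t) i
        ; ⋁-least = λ f h t → A.⋁-least (λ i → f i t) (λ i → h i t) }
    ; _*_ = λ v x t → v A.* x t
    ; *-mono = λ p q t → A.*-mono p (q t)
    ; *-⋁ʳ = λ u f → pw (λ t → A.*-⋁ʳ u (λ i → f i t))
    ; *-⋁ˡ = λ g a → pw (λ t → A.*-⋁ˡ g (a t))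
    ; *-assoc = λ u v a → pw (λ t → A.*-assoc u v (a t))
    ; *-identity = λ a → pw (λ t → A.*-identity (a t)) }
    where
      module A = Module A
      pw : {x y : T → A.Carrier} → ((t : T) → x t A.≈ y t) →
           ((t : T) → x t A.≤ y t) × ((t : T) → y t A.≤ x t)
      pw h = (λ t → proj₁ (h t)) , (λ t → proj₂ (h t))

module _ {V : Quantale} (M : Module V) where
  private
    module V = Quantale V
    module M = Module M
  open M

  record IsPrenucleus (j : Carrier → Carrier) : Set where
    field
      infl : ∀ a → a ≤ j a
      mono : ∀ {a b} → a ≤ b → j a ≤ j b
      act  : ∀ v a → v * j a ≤ j (v * a)

  record IsNucleus (k : Carrier → Carrier) : Set where
    field
      prenucleus : IsPrenucleus k
      idem       : ∀ a → k (k a) ≤ k a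
    open IsPrenucleus prenucleus public

  Fixed : (Carrier → Carrier) → Carrier → Set
  Fixed j a = j a ≈ a

  n : (Carrier → Carrier) → Carrier → Carrier
  n j a = ⋀ {Σ Carrier (λ x → Fixed j x × (a ≤ x))} proj₁

  module _ {j : Carrier → Carrier} (P : IsPrenucleus j) where
    private module P = IsPrenucleus P

    n-infl : ∀ a → a ≤ n j a
    n-infl a = ⋀-glb proj₁ (λ p → proj₂ (proj₂ p))

    n-fixed : ∀ a → Fixed j (n j a)
    n-fixed a = ⋀-glb proj₁ (λ p → ≤-trans (P.mono (⋀-lb proj₁ p)) (proj₁ (proj₁ (proj₂ p))))
              , P.infl (n j a)

    n-mono : ∀ {a b} → a ≤ b → n j a ≤ n j b
    n-mono a≤b = ⋀-glb proj₁ (λ p → ⋀-lb proj₁ (proj₁ p , proj₁ (proj₂ p) , ≤-trans a≤b (proj₂ (proj₂ p))))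

    n-idem : ∀ a → n j (n j a) ≤ n j a
    n-idem a = ⋀-lb proj₁ (n j a , n-fixed a , ≤-refl)

    private
      res : V.Carrier → Carrier → Carrier
      res v z = ⋁ {Σ Carrier (λ b → v * b ≤ z)} proj₁

      res-counit : ∀ v z → v * res v z ≤ z
      res-counit v z = ≤-trans (proj₁ (*-⋁ʳ v proj₁)) (⋁-least _ (λ p → proj₂ p))

    n-act : ∀ v a → v * n j a ≤ n j (v * a)
    n-act v a = ≤-trans (*-mono V.≤-refl nA≤w) (res-counit v z)
      where
        z = n j (v * a)
        w = res v z
        wfix : Fixed j w
        wfix = ⋁-ub proj₁ (j w , ≤-trans (P.act v w)
                  (≤-trans (P.mono (res-counit v z)) (proj₁ (n-fixed (v * a)))))
             , P.infl w
        nA≤w : n j a ≤ w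
        nA≤w = ⋀-lb proj₁ (w , wfix , ⋁-ub proj₁ (a , n-infl (v * a)))

    n-nucleus : IsNucleus (n j)
    n-nucleus = record
      { prenucleus = record { infl = n-infl ; mono = n-mono ; act = n-act }
      ; idem = n-idem }

  module _ {k : Carrier → Carrier} (N : IsNucleus k) where
    private module N = IsNucleus N

    k-cong : ∀ {a b} → a ≈ b → k a ≈ k b
    k-cong (p , q) = N.mono p , N.mono q

    k-fix : ∀ a → Fixed k (k a)
    k-fix a = N.idem a , N.infl (k a)

    private
      K1 : ∀ v a → k (v * k a) ≈ k (v * a)
      K1 v a = ≤-trans (N.mono (N.act v a)) (N.idem (v * a))
             , N.mono (*-mono V.≤-refl (N.infl a))

      K2 : ∀ {I : Set} (f : I → Carrier) → k (⋁ (λ i → k (f i))) ≈ k (⋁ f)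
      K2 f = ≤-trans (N.mono (⋁-least _ (λ i → N.mono (⋁-ub f i)))) (N.idem (⋁ f))
           , N.mono (⋁-mono f _ (λ i → N.infl (f i)))

    toFix : Carrier → Σ Carrier (Fixed k)
    toFix a = k a , k-fix a

    FixModule : Module V
    FixModule = record
      { lattice = record
          { Carrier = Σ Carrier (Fixed k)
          ; _≤_ = λ x y → proj₁ x ≤ proj₁ y
          ; ≤-refl = ≤-refl
          ; ≤-trans = ≤-trans
          ; ⋁ = λ f → toFix (⋁ (λ i → proj₁ (f i)))
          ; ⋁-ub = λ f i → ≤-trans (⋁-ub (λ i → proj₁ (f i)) i) (N.infl _)
          ; ⋁-least = λ f {a} h → ≤-trans (N.mono (⋁-least _ h)) (proj₁ (proj₂ a)) }
      ; _*_ = λ v m → toFix (v * proj₁ m)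
      ; *-mono = λ p q → N.mono (*-mono p q)
      ; *-⋁ʳ = λ u f → ≈-trans (K1 u (⋁ (λ i → proj₁ (f i))))
                         (≈-trans (k-cong (*-⋁ʳ u (λ i → proj₁ (f i))))
                                  (≈-sym (K2 (λ i → u * proj₁ (f i)))))
      ; *-⋁ˡ = λ g a → ≈-trans (k-cong (*-⋁ˡ g (proj₁ a)))
                         (≈-sym (K2 (λ i → g i * proj₁ a)))
      ; *-assoc = λ u v a → ≈-trans (K1 u (v * proj₁ a)) (k-cong (*-assoc u v (proj₁ a)))
      ; *-identity = λ a → ≈-trans (k-cong (*-identity (proj₁ a))) (proj₂ a) }

  -- j[X] for X = { (p κ , q κ) | κ ∈ K } ⊆ M × M :
  -- j[X](a) = a ∨ ⋁ { c | ∃ d ≤ a : (c,d) ∈ X or (d,c) ∈ X }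
  jIdx : (K : Set) (p q : K → Carrier) → Carrier → Set
  jIdx K p q a = Σ K (λ κ → (q κ ≤ a) ⊎ (p κ ≤ a))

  jSel : (K : Set) (p q : K → Carrier) (a : Carrier) → jIdx K p q a → Carrier
  jSel K p q a (κ , inj₁ _) = p κ
  jSel K p q a (κ , inj₂ _) = q κ

  jRel : (K : Set) (p q : K → Carrier) → Carrier → Carrier
  jRel K p q a = a ∨ ⋁ {jIdx K p q a} (jSel K p q a)

  jRel-prenucleus : (K : Set) (p q : K → Carrier) →
    (∀ v κ → Σ K (λ κ' → (p κ' ≈ v * p κ) × (q κ' ≈ v * q κ))) →
    IsPrenucleus (jRel K p q)
  jRel-prenucleus K p q cl = record { infl = λ a → ∨-left ; mono = mono ; act = act }
    where
      mono : ∀ {a b} → a ≤ b → jRel K p q a ≤ jRel K p q b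
      mono {a} {b} a≤b = ∨-least (≤-trans a≤b ∨-left)
        (≤-trans (⋁-least (jSel K p q a) el) ∨-right)
        where
          el : (i : jIdx K p q a) → jSel K p q a i ≤ ⋁ (jSel K p q b)
          el (κ , inj₁ h) = ⋁-ub (jSel K p q b) (κ , inj₁ (≤-trans h a≤b))
          el (κ , inj₂ h) = ⋁-ub (jSel K p q b) (κ , inj₂ (≤-trans h a≤b))
      act : ∀ v a → v * jRel K p q a ≤ jRel K p q (v * a)
      act v a = ≤-trans (proj₁ (*-⋁ʳ v (pick a (⋁ (jSel K p q a)))))
                        (⋁-least _ part)
        where
          el : (i : jIdx K p q a) → v * jSel K p q a i ≤ ⋁ (jSel K p q (v * a))
          el (κ , inj₁ h) = ≤-trans (proj₂ (proj₁ (proj₂ (cl v κ))))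
            (⋁-ub (jSel K p q (v * a))
              (proj₁ (cl v κ) , inj₁ (≤-trans (proj₁ (proj₂ (proj₂ (cl v κ)))) (*-mono V.≤-refl h))))
          el (κ , inj₂ h) = ≤-trans (proj₂ (proj₂ (proj₂ (cl v κ))))
            (⋁-ub (jSel K p q (v * a))
              (proj₁ (cl v κ) , inj₂ (≤-trans (proj₁ (proj₁ (proj₂ (cl v κ)))) (*-mono V.≤-refl h))))
          part : (b : Bool) → v * pick a (⋁ (jSel K p q a)) b ≤ jRel K p q (v * a)
          part true  = ∨-left
          part false = ≤-trans (proj₁ (*-⋁ʳ v (jSel K p q a)))
                               (≤-trans (⋁-least _ el) ∨-right)

module Tensor {V : Quantale} (J : Frame V) (H : FSemilattice V) where
  private
    module V = Quantale V
    module J = Frame J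
    module H = FSemilattice H
    module A = Module H.mod
    F : A.Carrier → A.Carrier
    F = Hom.fun H.F

  AT : Module V
  AT = H.mod ^ J.T
  private module AT = Module AT

  x-ir : A.Carrier → J.T → AT.Carrier
  x-ir x i t = J.r i t A.* x

  -- x_{i=}(i) = x and x_{i=}(t) = 0 for t ≠ i.  Rendered constructively as
  -- the join of the family (i ≡ t) ↦ x, which is x if t = i and ⋁ ∅ = 0 otherwise.
  x-eq : A.Carrier → J.T → AT.Carrier
  x-eq x i t = A.⋁ {i ≡ t} (λ _ → x)

  -- [J,H] = { (x_{ir} ∨ F(x)_{i=} , F(x)_{i=}) | x ∈ A, i ∈ T }
  gen₁ gen₂ : A.Carrier × J.T → AT.Carrier
  gen₁ (x , i) = x-ir x i AT.∨ x-eq (F x) i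
  gen₂ (x , i) = x-eq (F x) i

  jJH : AT.Carrier → AT.Carrier
  jJH = jRel AT (A.Carrier × J.T) gen₁ gen₂

  private
    pw : {x y : AT.Carrier} → ((t : J.T) → x t A.≈ y t) → x AT.≈ y
    pw h = (λ t → proj₁ (h t)) , (λ t → proj₂ (h t))

    eq-act : ∀ v x i t → x-eq (F (v A.* x)) i t A.≈ (v A.* x-eq (F x) i t)
    eq-act v x i t = A.≈-trans (A.⋁-cong _ _ (λ _ → Hom.*-pres H.F v x))
                               (A.≈-sym (A.*-⋁ʳ v (λ _ → F x)))

    r-act : ∀ v x i t → x-ir (v A.* x) i t A.≈ (v A.* x-ir x i t)
    r-act v x i t = A.≈-trans (A.*-assoc (J.r i t) v x)
      (A.≈-trans (A.*-mono (proj₁ (V.⊗-comm (J.r i t) v)) A.≤-refl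
                 , A.*-mono (proj₂ (V.⊗-comm (J.r i t) v)) A.≤-refl)
                 (A.≈-sym (A.*-assoc v (J.r i t) x)))

    closed : ∀ v κ → Σ (A.Carrier × J.T)
               (λ κ' → (gen₁ κ' AT.≈ v AT.* gen₁ κ) × (gen₂ κ' AT.≈ v AT.* gen₂ κ))
    closed v (x , i) = (v A.* x , i) , pw p , pw (eq-act v x i)
      where
        p : (t : J.T) → gen₁ (v A.* x , i) t A.≈ (v A.* gen₁ (x , i) t)
        p t = A.≈-trans (A.⋁-cong _ _ c) (A.≈-sym (A.*-⋁ʳ v _))
          where
            c : (b : Bool) → AT.pick (x-ir (v A.* x) i) (x-eq (F (v A.* x)) i) b t
                             A.≈ (v A.* AT.pick (x-ir x i) (x-eq (F x) i) b t)
            c true  = r-act v x i t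
            c false = eq-act v x i t

  jJH-prenucleus : IsPrenucleus AT jJH
  jJH-prenucleus = jRel-prenucleus AT (A.Carrier × J.T) gen₁ gen₂ closed

  nJH : AT.Carrier → AT.Carrier
  nJH = n AT jJH

  nJH-nucleus : IsNucleus AT nJH
  nJH-nucleus = n-nucleus AT jJH-prenucleus

  tensor : Module V
  tensor = FixModule AT nJH-nucleus

  quot : AT.Carrier → Module.Carrier tensor
  quot = toFix AT nJH-nucleus

infixl 6 _⊗ₜ_
_⊗ₜ_ : {V : Quantale} → Frame V → FSemilattice V → Module V
J ⊗ₜ H = Tensor.tensor J H

-- Since every element y of J₁ ⊗ H satisfies y = n(j[J₁,H])(y), the unique
-- homomorphism h with n(j[J₂,H]) ∘ t→ = h ∘ n(j[J₁,H]) is y ↦ n(j[J₂,H])(t→(y)).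

module _ {V : Quantale} {J₁ J₂ : Frame V} (H : FSemilattice V) where
  private
    module A = Module (FSemilattice.mod H)

  push : (Frame.T J₁ → Frame.T J₂) → (Frame.T J₁ → A.Carrier) → Frame.T J₂ → A.Carrier
  push t x k = A.⋁ {Σ (Frame.T J₁) (λ i → t i ≡ k)} (λ p → x (proj₁ p))

  tensorMap : (Frame.T J₁ → Frame.T J₂) → Module.Carrier (J₁ ⊗ₜ H) → Module.Carrier (J₂ ⊗ₜ H)
  tensorMap t y = Tensor.quot J₂ H (push t (proj₁ y))

module _ {V : Quantale} (H : FSemilattice V) where
  private
    module V = Quantale V
    module H = FSemilattice H
    module A = Module H.mod
    F : A.Carrier → A.Carrier
    F = Hom.fun H.F

  JHom : Module V → Frame V
  JHom L = record
    { T = Hom H.mod L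
    ; r = λ α β → V.⋀ {A.Carrier} (λ x → Module._⇒_ L (Hom.fun β x) (Hom.fun α (F x))) }

  JHomMap : {L₁ L₂ : Module V} → Hom L₁ L₂ → Frame.T (JHom L₁) → Frame.T (JHom L₂)
  JHomMap g α = g ∘H α

  fL : (L : Module V) → (Hom H.mod L → A.Carrier) → Module.Carrier L
  fL L x = Module.⋁ L {Hom H.mod L} (λ α → Hom.fun α (x α))

-- J ⊗ H is the quotient of A^T by the nucleus n(j[J,H]).  A module homomorphism out
-- of A^T that sends each generator x_{ir} ∨ F(x)_{i=} below the image of F(x)_{i=} is
-- invariant under n(j[J,H]) and so descends to J ⊗ H; this produces ψ_L from f_L (the
-- generators are identified because r(α,β) is the residual β(x) → α(F x)) and makes
-- t ⊗ H computable on representatives.  φ_J(i) is the point mass x ↦ [x_{i=}], and the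
-- triangle identities reduce to the decomposition of y ∈ A^T as the join of the
-- point masses y(i)_{i=}.

module Submission where

open import Defs
open import Data.Product using (Σ; _×_; _,_; proj₁; proj₂)
open import Data.Sum using (inj₁; inj₂)
open import Data.Bool using (true; false)
open import Level using (0ℓ)
open import Relation.Binary.Bundles using (Poset)
open import Relation.Binary.PropositionalEquality using (refl)
import Relation.Binary.Reasoning.PartialOrder as PosetReasoning

lattice-poset : CompleteLattice → Poset 0ℓ 0ℓ 0ℓ
lattice-poset C = record
  { Carrier = C.Carrier
  ; _≈_ = C._≈_
  ; _≤_ = C._≤_
  ; isPartialOrder = record
      { isPreorder = record
          { isEquivalence = record { refl = C.≈-refl ; sym = C.≈-sym ; trans = C.≈-trans }
          ; reflexive = proj₁
          ; trans = C.≤-trans }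
      ; antisym = _,_ } }
  where module C = CompleteLattice C

module ≤-Reasoning {V : Quantale} (L : Module V) =
  PosetReasoning (lattice-poset (Module.lattice L))

Hom-cong : {V : Quantale} {A L : Module V} (h : Hom A L) {a b : Module.Carrier A} →
           Module._≈_ A a b → Module._≈_ L (Hom.fun h a) (Hom.fun h b)
Hom-cong h (a≤b , b≤a) = Hom.mono h a≤b , Hom.mono h b≤a

module _ {V : Quantale} (L : Module V) where
  private
    module V = Quantale V
    module L = Module L

  ⇒-intro : ∀ {u a b} → u L.* a L.≤ b → u V.≤ a L.⇒ b
  ⇒-intro {u} u*a≤b = V.⋁-ub proj₁ (u , u*a≤b)

  ⇒-elim : ∀ {u a b} → u V.≤ a L.⇒ b → u L.* a L.≤ b
  ⇒-elim {u} {a} u≤a⇒b = L.≤-trans (L.*-mono u≤a⇒b L.≤-refl)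
    (L.≤-trans (proj₁ (L.*-⋁ˡ proj₁ a)) (L.⋁-least _ proj₂))

module _ {V : Quantale} (M : Module V) {k : Module.Carrier M → Module.Carrier M}
         (N : IsNucleus M k) where
  private
    module V = Quantale V
    module M = Module M
    module N = IsNucleus N
    module Mk = Module (FixModule M N)

  toFix-fixed : (z : Mk.Carrier) → toFix M N (proj₁ z) Mk.≈ z
  toFix-fixed (_ , kz≈z) = kz≈z

  toFixHom : Hom M (FixModule M N)
  toFixHom = mkHom (toFix M N) N.mono
    (λ f → N.mono (M.⋁-mono _ _ (λ i → N.infl (f i)))
         , M.≤-trans (N.mono (M.⋁-least _ (λ i → N.mono (M.⋁-ub f i)))) (N.idem (M.⋁ f)))
    (λ v a → N.mono (M.*-mono V.≤-refl (N.infl a))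
           , M.≤-trans (N.mono (N.act v a)) (N.idem (v M.* a)))

  module _ {L : Module V} (h : Hom M L)
           (h-k≤h : ∀ a → Module._≤_ L (Hom.fun h (k a)) (Hom.fun h a)) where
    private
      module L = Module L
      h-k≈h : ∀ a → Hom.fun h (k a) L.≈ Hom.fun h a
      h-k≈h a = h-k≤h a , Hom.mono h (N.infl a)

    descend : Hom (FixModule M N) L
    descend = mkHom (λ z → Hom.fun h (proj₁ z)) (Hom.mono h)
      (λ f → L.≈-trans (h-k≈h _) (Hom-⋁ h (λ i → proj₁ (f i))))
      (λ v z → L.≈-trans (h-k≈h _) (Hom.*-pres h v (proj₁ z)))

    descend-toFix : ∀ a → Hom.fun descend (toFix M N a) L.≈ Hom.fun h a
    descend-toFix = h-k≈h

    descend-unique : (g : Hom (FixModule M N) L) →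
                     (∀ a → Hom.fun g (toFix M N a) L.≈ Hom.fun h a) →
                     ∀ z → Hom.fun g z L.≈ Hom.fun descend z
    descend-unique g g-toFix z = L.≈-trans (Hom-cong g {z} {toFix M N y} z≈y) (g-toFix y)
      where
        y = proj₁ z
        z≈y : z Mk.≈ toFix M N y
        z≈y = Mk.≈-sym {toFix M N y} {z} (toFix-fixed z)

module _ {V : Quantale} (M : Module V) {K : Set} (p q : K → Module.Carrier M) where
  private
    module M = Module M
    j = jRel M K p q

  p≤n-jRel-q : IsPrenucleus M j → ∀ κ → p κ M.≤ n M j (q κ)
  p≤n-jRel-q P κ = M.≤-trans (M.≤-trans p≤sel M.∨-right) (proj₁ (n-fixed M P (q κ)))
    where
      p≤sel : p κ M.≤ M.⋁ (jSel M K p q (n M j (q κ)))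
      p≤sel = M.⋁-ub (jSel M K p q (n M j (q κ))) (κ , inj₁ (n-infl M P (q κ)))

  -- The largest element w with h w ≤ h y is closed under j, hence lies above n j y.
  n-jRel-invariant : {L : Module V} (h : Hom M L) →
    (∀ κ → Module._≤_ L (Hom.fun h (p κ)) (Hom.fun h (q κ))) →
    (∀ κ → Module._≤_ L (Hom.fun h (q κ)) (Hom.fun h (p κ))) →
    ∀ y → Module._≤_ L (Hom.fun h (n M j y)) (Hom.fun h y)
  n-jRel-invariant {L} h h-p≤q h-q≤p y = L.≤-trans (Hom.mono h ny≤w) hw≤hy
    where
      module L = Module L
      w : M.Carrier
      w = M.⋁ {Σ M.Carrier (λ a → Hom.fun h a L.≤ Hom.fun h y)} proj₁
      hw≤hy : Hom.fun h w L.≤ Hom.fun h y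
      hw≤hy = Hom.⋁-pres h (Hom.fun h y)
      ≤w : ∀ a → Hom.fun h a L.≤ Hom.fun h y → a M.≤ w
      ≤w a ha≤hy = M.⋁-ub proj₁ (a , ha≤hy)
      sel≤w : (s : jIdx M K p q w) → jSel M K p q w s M.≤ w
      sel≤w (κ , inj₁ qκ≤w) =
        ≤w (p κ) (L.≤-trans (h-p≤q κ) (L.≤-trans (Hom.mono h qκ≤w) hw≤hy))
      sel≤w (κ , inj₂ pκ≤w) =
        ≤w (q κ) (L.≤-trans (h-q≤p κ) (L.≤-trans (Hom.mono h pκ≤w) hw≤hy))
      w-fixed : Fixed M j w
      w-fixed = M.∨-least M.≤-refl (M.⋁-least _ sel≤w) , M.∨-left
      ny≤w : n M j y M.≤ w
      ny≤w = M.⋀-lb proj₁ (w , w-fixed , ≤w y L.≤-refl)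

module TensorProperties {V : Quantale} (J : Frame V) (H : FSemilattice V) where
  open Tensor J H
  private
    module V = Quantale V
    module J = Frame J
    module A = Module (FSemilattice.mod H)
    module AT = Module AT
    module J⊗H = Module (J ⊗ₜ H)
    module N = IsNucleus nJH-nucleus
    F : A.Carrier → A.Carrier
    F = Hom.fun (FSemilattice.F H)

  quotHom : Hom AT (J ⊗ₜ H)
  quotHom = toFixHom AT nJH-nucleus

  x-eqHom : J.T → Hom (FSemilattice.mod H) AT
  x-eqHom i = mkHom (λ x → x-eq x i) (λ x≤y t → A.⋁-mono _ _ (λ _ → x≤y))
    (λ g → (λ t → A.⋁-least _ (λ e → A.⋁-least g (λ k →
                    A.≤-trans (A.⋁-ub (λ _ → g k) e) (A.⋁-ub _ k))))
         , (λ t → A.⋁-least _ (λ k → A.⋁-mono _ _ (λ _ → A.⋁-ub g k))))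
    (λ v x → (λ t → proj₂ (A.*-⋁ʳ v (λ _ → x))) , (λ t → proj₁ (A.*-⋁ʳ v (λ _ → x))))

  ⋁-x-eq : (y : AT.Carrier) → AT.⋁ (λ i → x-eq (y i) i) AT.≈ y
  ⋁-x-eq y = (λ t → A.⋁-least _ (λ i → A.⋁-least _ (λ { refl → A.≤-refl })))
           , (λ t → A.≤-trans (A.⋁-ub (λ _ → y t) refl) (A.⋁-ub (λ i → x-eq (y i) i t) t))

  r*x-eq≤x-ir : ∀ i j x → J.r i j AT.* x-eq x j AT.≤ x-ir x i
  r*x-eq≤x-ir i j x t =
    A.≤-trans (proj₁ (A.*-⋁ʳ (J.r i j) (λ _ → x))) (A.⋁-least _ (λ { refl → A.≤-refl }))

  gen₂≤gen₁ : ∀ κ → gen₂ κ AT.≤ gen₁ κ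
  gen₂≤gen₁ (x , i) = AT.∨-right {x-ir x i} {x-eq (F x) i}

  quot-gen₁≤gen₂ : ∀ κ → quot (gen₁ κ) J⊗H.≤ quot (gen₂ κ)
  quot-gen₁≤gen₂ κ =
    AT.≤-trans (N.mono (p≤n-jRel-q AT gen₁ gen₂ jJH-prenucleus κ)) (N.idem (gen₂ κ))

  n-invariant : {L : Module V} (h : Hom AT L) →
    (∀ κ → Module._≤_ L (Hom.fun h (gen₁ κ)) (Hom.fun h (gen₂ κ))) →
    ∀ y → Module._≤_ L (Hom.fun h (nJH y)) (Hom.fun h y)
  n-invariant h h-gen =
    n-jRel-invariant AT gen₁ gen₂ h h-gen (λ κ → Hom.mono h (gen₂≤gen₁ κ))

  φ : FrameHom J (JHom H (J ⊗ₜ H))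
  φ = record { fun = λ i → quotHom ∘H x-eqHom i ; r-le = r-le }
    where
      r*φ≤φF : ∀ i j x → J.r i j J⊗H.* quot (x-eq x j) J⊗H.≤ quot (x-eq (F x) i)
      r*φ≤φF i j x = begin
        J.r i j J⊗H.* quot (x-eq x j)  ≈⟨ Hom.*-pres quotHom (J.r i j) (x-eq x j) ⟨
        quot (J.r i j AT.* x-eq x j)   ≤⟨ Hom.mono quotHom (r*x-eq≤x-ir i j x) ⟩
        quot (x-ir x i)                ≤⟨ Hom.mono quotHom (AT.∨-left {x-ir x i} {x-eq (F x) i}) ⟩
        quot (gen₁ (x , i))            ≤⟨ quot-gen₁≤gen₂ (x , i) ⟩
        quot (x-eq (F x) i)            ∎
        where open ≤-Reasoning (J ⊗ₜ H)
      r-le : ∀ i j → J.r i j V.≤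
                     Frame.r (JHom H (J ⊗ₜ H)) (quotHom ∘H x-eqHom i) (quotHom ∘H x-eqHom j)
      r-le i j = V.⋀-glb _ (λ x →
        ⇒-intro (J ⊗ₜ H) {a = quot (x-eq x j)} {quot (x-eq (F x) i)} (r*φ≤φF i j x))

module PushProperties {V : Quantale} {J₁ J₂ : Frame V} (H : FSemilattice V) where
  private
    module J₁ = Frame J₁
    module J₂ = Frame J₂
    module T₁ = Tensor J₁ H
    module T₂ = Tensor J₂ H
    module P₁ = TensorProperties J₁ H
    module P₂ = TensorProperties J₂ H
    module A = Module (FSemilattice.mod H)
    module AT₂ = Module T₂.AT
    module J₂⊗H = Module (J₂ ⊗ₜ H)
    push₁₂ = push {J₁ = J₁} {J₂ = J₂} H
    tensorMap₁₂ = tensorMap {J₁ = J₁} {J₂ = J₂} H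

  pushHom : (t : J₁.T → J₂.T) → Hom T₁.AT T₂.AT
  pushHom t = mkHom (push₁₂ t) (λ x≤y k → A.⋁-mono _ _ (λ q → x≤y (proj₁ q)))
    (λ g → (λ k → A.⋁-least _ (λ q → A.⋁-least _ (λ m →
                    A.≤-trans (A.⋁-ub (λ q' → g m (proj₁ q')) q) (A.⋁-ub _ m))))
         , (λ k → A.⋁-least _ (λ m → A.⋁-mono _ _ (λ q → A.⋁-ub (λ m' → g m' (proj₁ q)) m))))
    (λ v x → (λ k → proj₂ (A.*-⋁ʳ v _)) , (λ k → proj₁ (A.*-⋁ʳ v _)))

  push-x-eq : (t : J₁.T → J₂.T) (x : A.Carrier) (i : J₁.T) →
              push₁₂ t (T₁.x-eq x i) AT₂.≈ T₂.x-eq x (t i)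
  push-x-eq t x i =
      (λ k → A.⋁-least _ (λ { (j , refl) → A.⋁-least _ (λ { refl → A.⋁-ub _ refl }) }))
    , (λ k → A.⋁-least _ (λ ti≡k →
               A.≤-trans (A.⋁-ub (λ _ → x) refl) (A.⋁-ub (λ q → T₁.x-eq x i (proj₁ q)) (i , ti≡k))))

  module _ (t : FrameHom J₁ J₂) where
    private
      t₀ = FrameHom.fun t

    push-gen₁≤gen₁ : ∀ x i → push₁₂ t₀ (T₁.gen₁ (x , i)) AT₂.≤ T₂.gen₁ (x , t₀ i)
    push-gen₁≤gen₁ x i k = A.⋁-least _ λ
      { (j , refl) → A.⋁-mono _ _ λ
          { true  → A.*-mono (FrameHom.r-le t i j) A.≤-refl
          ; false → A.⋁-least _ (λ { refl → A.⋁-ub _ refl }) } }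

    quot-push-gen₁≤gen₂ : ∀ κ → Hom.fun (P₂.quotHom ∘H pushHom t₀) (T₁.gen₁ κ)
                                 J₂⊗H.≤ Hom.fun (P₂.quotHom ∘H pushHom t₀) (T₁.gen₂ κ)
    quot-push-gen₁≤gen₂ (x , i) = begin
      T₂.quot (push₁₂ t₀ (T₁.gen₁ (x , i)))  ≤⟨ Hom.mono P₂.quotHom (push-gen₁≤gen₁ x i) ⟩
      T₂.quot (T₂.gen₁ (x , t₀ i))          ≤⟨ P₂.quot-gen₁≤gen₂ (x , t₀ i) ⟩
      T₂.quot (T₂.gen₂ (x , t₀ i))          ≈⟨ Hom-cong P₂.quotHom (push-x-eq t₀ _ i) ⟨
      T₂.quot (push₁₂ t₀ (T₁.gen₂ (x , i)))  ∎
      where open ≤-Reasoning (J₂ ⊗ₜ H)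

    tensorMap-quot : ∀ y → tensorMap₁₂ t₀ (T₁.quot y) J₂⊗H.≈ T₂.quot (push₁₂ t₀ y)
    tensorMap-quot y =
        P₁.n-invariant (P₂.quotHom ∘H pushHom t₀) quot-push-gen₁≤gen₂ y
      , Hom.mono (P₂.quotHom ∘H pushHom t₀) (IsNucleus.infl T₁.nJH-nucleus y)

    φ-natural : ∀ i x → tensorMap₁₂ t₀ (Hom.fun (FrameHom.fun P₁.φ i) x)
                        J₂⊗H.≈ Hom.fun (FrameHom.fun P₂.φ (t₀ i)) x
    φ-natural i x = begin-equality
      tensorMap₁₂ t₀ (T₁.quot (T₁.x-eq x i))  ≈⟨ tensorMap-quot (T₁.x-eq x i) ⟩
      T₂.quot (push₁₂ t₀ (T₁.x-eq x i))       ≈⟨ Hom-cong P₂.quotHom (push-x-eq t₀ x i) ⟩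
      T₂.quot (T₂.x-eq x (t₀ i))             ∎
      where open ≤-Reasoning (J₂ ⊗ₜ H)

module HomFrameProperties {V : Quantale} (H : FSemilattice V) (L : Module V) where
  open Tensor (JHom H L) H
  open TensorProperties (JHom H L) H
  private
    module V = Quantale V
    module A = Module (FSemilattice.mod H)
    module AT = Module AT
    module L = Module L
    F : A.Carrier → A.Carrier
    F = Hom.fun (FSemilattice.F H)

  fLHom : Hom AT L
  fLHom = mkHom (fL H L) (λ x≤y → L.⋁-mono _ _ (λ α → Hom.mono α (x≤y α)))
    (λ g → L.⋁-least _ (λ α → L.≤-trans (proj₁ (Hom-⋁ α (λ m → g m α)))
              (L.⋁-least _ (λ m → L.≤-trans (L.⋁-ub (λ β → Hom.fun β (g m β)) α) (L.⋁-ub _ m))))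
         , L.⋁-least _ (λ m → L.⋁-mono _ _ (λ α → Hom.mono α (A.⋁-ub (λ m' → g m' α) m))))
    (λ v y → L.≈-trans (L.⋁-cong _ _ (λ α → Hom.*-pres α v (y α))) (L.≈-sym (L.*-⋁ʳ v _)))

  fL-x-eq : ∀ x α → fL H L (x-eq x α) L.≈ Hom.fun α x
  fL-x-eq x α =
      L.⋁-least _ (λ β → L.≤-trans (proj₁ (Hom-⋁ β (λ _ → x))) (L.⋁-least _ (λ { refl → L.≤-refl })))
    , L.≤-trans (Hom.mono α (A.⋁-ub (λ _ → x) refl)) (L.⋁-ub (λ β → Hom.fun β (x-eq x α β)) α)

  fL-push : {J : Frame V} (t : Frame.T J → Hom (FSemilattice.mod H) L)
            (y : Frame.T J → A.Carrier) →
            fL H L (push {J₁ = J} {J₂ = JHom H L} H t y) L.≈ L.⋁ (λ i → Hom.fun (t i) (y i))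
  fL-push {J} t y =
      L.⋁-least _ (λ β → L.≤-trans (proj₁ (Hom-⋁ β _)) (L.⋁-least _ (λ { (i , refl) → L.⋁-ub _ i })))
    , L.⋁-least _ (λ i → L.≤-trans (Hom.mono (t i) (A.⋁-ub (λ q → y (proj₁ q)) (i , refl)))
                                   (L.⋁-ub (λ β → Hom.fun β (t→y β)) (t i)))
    where
      t→y = push {J₁ = J} {J₂ = JHom H L} H t y

  -- The β-summand of r(α,β) * x is absorbed into α(F x) by the definition of r as a residual.
  fL-gen₁≤gen₂ : ∀ κ → fL H L (gen₁ κ) L.≤ fL H L (gen₂ κ)
  fL-gen₁≤gen₂ (x , α) = L.⋁-least _ summand≤
    where
      summand≤ : ∀ β → Hom.fun β (gen₁ (x , α) β) L.≤ fL H L (gen₂ (x , α))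
      summand≤ β = L.≤-trans (proj₁ (Hom-⋁ β _)) (L.⋁-least _ λ
        { true  → L.≤-trans (proj₁ (Hom.*-pres β _ x))
                    (L.≤-trans (⇒-elim L (V.⋀-lb _ x)) (proj₂ (fL-x-eq (F x) α)))
        ; false → L.⋁-ub (λ β → Hom.fun β (gen₂ (x , α) β)) β })

  fL-n-invariant : ∀ y → fL H L (nJH y) L.≤ fL H L y
  fL-n-invariant = n-invariant fLHom fL-gen₁≤gen₂

  ψ : Hom (JHom H L ⊗ₜ H) L
  ψ = descend AT nJH-nucleus fLHom fL-n-invariant

  ψ-quot : ∀ y → Hom.fun ψ (quot y) L.≈ fL H L y
  ψ-quot = descend-toFix AT nJH-nucleus fLHom fL-n-invariant

  ψ-unique : (ψ′ : Hom (JHom H L ⊗ₜ H) L) → (∀ y → Hom.fun ψ′ (quot y) L.≈ fL H L y) →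
             ∀ z → Hom.fun ψ′ z L.≈ Hom.fun ψ z
  ψ-unique = descend-unique AT nJH-nucleus fLHom fL-n-invariant

  triangle-JHom : ∀ α x → Hom.fun ψ (Hom.fun (FrameHom.fun φ α) x) L.≈ Hom.fun α x
  triangle-JHom α x = L.≈-trans (ψ-quot (x-eq x α)) (fL-x-eq x α)

module _ {V : Quantale} (H : FSemilattice V) {L₁ L₂ : Module V} (g : Hom L₁ L₂) where
  private
    module L₂ = Module L₂
    module P₁ = HomFrameProperties H L₁
    module P₂ = HomFrameProperties H L₂

  ψ-natural : (z : Module.Carrier (JHom H L₁ ⊗ₜ H)) →
    Hom.fun P₂.ψ (tensorMap {J₁ = JHom H L₁} {J₂ = JHom H L₂} H (JHomMap H g) z)
      L₂.≈ Hom.fun g (Hom.fun P₁.ψ z)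
  ψ-natural (y , _) = begin-equality
    Hom.fun P₂.ψ (Tensor.quot (JHom H L₂) H y′)  ≈⟨ P₂.ψ-quot y′ ⟩
    fL H L₂ y′                                   ≈⟨ P₂.fL-push {JHom H L₁} (JHomMap H g) y ⟩
    L₂.⋁ (λ α → Hom.fun g (Hom.fun α (y α)))     ≈⟨ Hom-⋁ g _ ⟨
    Hom.fun g (fL H L₁ y)                        ∎
    where
      open ≤-Reasoning L₂
      y′ = push {J₁ = JHom H L₁} {J₂ = JHom H L₂} H (JHomMap H g) y

module _ {V : Quantale} (J : Frame V) (H : FSemilattice V) where
  open Tensor J H
  open TensorProperties J H
  open HomFrameProperties H (J ⊗ₜ H)

  triangle-⊗ : (z : Module.Carrier (J ⊗ₜ H)) →
    Module._≈_ (J ⊗ₜ H)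
      (Hom.fun ψ (tensorMap {J₁ = J} {J₂ = JHom H (J ⊗ₜ H)} H (FrameHom.fun φ) z)) z
  triangle-⊗ z@(y , _) = begin-equality
    Hom.fun ψ (Tensor.quot (JHom H (J ⊗ₜ H)) H y′)  ≈⟨ ψ-quot y′ ⟩
    fL H (J ⊗ₜ H) y′                               ≈⟨ fL-push {J} (FrameHom.fun φ) y ⟩
    J⊗H.⋁ (λ i → quot (x-eq (y i) i))              ≈⟨ Hom-⋁ quotHom (λ i → x-eq (y i) i) ⟨
    quot (AT.⋁ (λ i → x-eq (y i) i))               ≈⟨ Hom-cong quotHom (⋁-x-eq y) ⟩
    quot y                                         ≈⟨ toFix-fixed AT nJH-nucleus z ⟩
    z                                              ∎
    where
      module J⊗H = Module (J ⊗ₜ H)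
      module AT = Module AT
      open ≤-Reasoning (J ⊗ₜ H)
      y′ = push {J₁ = J} {J₂ = JHom H (J ⊗ₜ H)} H (FrameHom.fun φ) y

mainTheorem2 :
  (V : Quantale) (H : FSemilattice V) →
  let A = Module.Carrier (FSemilattice.mod H) in
  -- φ_J : J → J[H, J ⊗ H]   and   ψ_L : J[H,L] ⊗ H → L
  Σ ((J : Frame V) → FrameHom J (JHom H (J ⊗ₜ H))) λ φ →
  Σ ((L : Module V) → Hom (JHom H L ⊗ₜ H) L) λ ψ →
  -- (1) φ_J(i)(x) = n(j[J,H])(x_{i=}), φ_J unique with this property, φ natural
  ( ((J : Frame V) →
       ((i : Frame.T J) (x : A) →
          Module._≈_ (J ⊗ₜ H) (Hom.fun (FrameHom.fun (φ J) i) x)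
                              (Tensor.quot J H (Tensor.x-eq J H x i)))
     × ((φ' : FrameHom J (JHom H (J ⊗ₜ H))) →
          ((i : Frame.T J) (x : A) →
             Module._≈_ (J ⊗ₜ H) (Hom.fun (FrameHom.fun φ' i) x)
                                 (Tensor.quot J H (Tensor.x-eq J H x i))) →
          (i : Frame.T J) (x : A) →
             Module._≈_ (J ⊗ₜ H) (Hom.fun (FrameHom.fun φ' i) x)
                                 (Hom.fun (FrameHom.fun (φ J) i) x)))
  × ((J₁ J₂ : Frame V) (t : FrameHom J₁ J₂) (i : Frame.T J₁) (x : A) →
       Module._≈_ (J₂ ⊗ₜ H)
         (tensorMap {J₁ = J₁} {J₂ = J₂} H (FrameHom.fun t) (Hom.fun (FrameHom.fun (φ J₁) i) x))
         (Hom.fun (FrameHom.fun (φ J₂) (FrameHom.fun t i)) x)) )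
  -- (2) ψ_L ∘ n(j[J[H,L],H]) = f_L, ψ_L unique with this property, ψ natural
  × ( ((L : Module V) →
         ((y : Hom (FSemilattice.mod H) L → A) →
            Module._≈_ L (Hom.fun (ψ L) (Tensor.quot (JHom H L) H y)) (fL H L y))
       × ((ψ' : Hom (JHom H L ⊗ₜ H) L) →
            ((y : Hom (FSemilattice.mod H) L → A) →
               Module._≈_ L (Hom.fun ψ' (Tensor.quot (JHom H L) H y)) (fL H L y)) →
            (z : Module.Carrier (JHom H L ⊗ₜ H)) →
               Module._≈_ L (Hom.fun ψ' z) (Hom.fun (ψ L) z)))
    × ((L₁ L₂ : Module V) (g : Hom L₁ L₂) (z : Module.Carrier (JHom H L₁ ⊗ₜ H)) →
         Module._≈_ L₂
           (Hom.fun (ψ L₂) (tensorMap {J₁ = JHom H L₁} {J₂ = JHom H L₂} H (JHomMap H g) z))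
           (Hom.fun g (Hom.fun (ψ L₁) z))) )
  -- (3) triangle identities
  × ( ((J : Frame V) (y : Module.Carrier (J ⊗ₜ H)) →
         Module._≈_ (J ⊗ₜ H)
           (Hom.fun (ψ (J ⊗ₜ H))
              (tensorMap {J₁ = J} {J₂ = JHom H (J ⊗ₜ H)} H (FrameHom.fun (φ J)) y))
           y)
    × ((L : Module V) (α : Hom (FSemilattice.mod H) L) (x : A) →
         Module._≈_ L
           (Hom.fun (ψ L) (Hom.fun (FrameHom.fun (φ (JHom H L)) α) x))
           (Hom.fun α x)) )
mainTheorem2 V H =
    (λ J → TensorProperties.φ J H)
  , (λ L → HomFrameProperties.ψ H L)
  , ( (λ J → (λ i x → Module.≈-refl (J ⊗ₜ H) {Tensor.quot J H (Tensor.x-eq J H x i)})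
           , (λ φ′ φ′-spec → φ′-spec))
    , (λ J₁ J₂ t → PushProperties.φ-natural {J₁ = J₁} {J₂ = J₂} H t) )
  , ( (λ L → HomFrameProperties.ψ-quot H L , HomFrameProperties.ψ-unique H L)
    , (λ L₁ L₂ g → ψ-natural H g) )
  , ( (λ J → triangle-⊗ J H)
    , (λ L → HomFrameProperties.triangle-JHom H L) )
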